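{- Suppose $\Lambda$ is a permutation local limit. Then there exists a sequence of permutations $(\tau_\ell)_{\ell\in\mathbb{N}}$ that converges locally to $\Lambda$ with the property that $|\tau_\ell|=\ell$ for each $\ell\in\mathbb{N}$.
   Context: A permutation of length $n$ is a bijection $\sigma:[n]\to[n]$; $S$ is the set of all permutations. For $\pi$ of length $k$ and $\sigma$ of length $n\ge k$, let $\rho_k(\pi,\sigma)$ be the number of $i\in\{1,\dots,n-k+1\}$ such that $\sigma(i)\sigma(i+1)\dots\sigma(i+k-1)$ is order-isomorphic to $\pi$, divided by $n-k+1$ (the density of consecutive occurrences of $\pi$). A sequence of permutations $(\sigma_j)_{j\in\mathbb{N}}$ with $|\sigma_j|\to\infty$ converges locally to $\Lambda\in[0,1]^S$ if $\rho_{|\pi|}(\pi,\sigma_j)\to\Lambda_\pi$ for every $\pi\in S$. A permutation local limit is any $\Lambda$ to which some sequence of permutations converges locally. -}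

module Defs where

open import Data.Nat using (ℕ; zero; suc; _+_; _∸_; _<_; _≤_; _<ᵇ_; _≤ᵇ_)
open import Data.Nat.Properties using (_<?_)
open import Data.Fin using (Fin; toℕ; fromℕ<)
open import Data.Bool using (Bool; true; false; _∧_; if_then_else_)
open import Data.Bool.Properties using (_≟_)
open import Data.List using (List; upTo; map; allFin)
open import Data.List using (foldr)
open import Data.Nat.ListAction using (sum)
open import Data.Integer using (+_)
open import Data.Rational using (ℚ; _/_; _-_; ∣_∣; 0ℚ) renaming (_<_ to _<ℚ_)
open import Data.Product using (Σ; ∃; _×_)
open import Function.Bundles using (_⤖_; Bijection)
open import Relation.Nullary using (does)

Perm : ℕ → Set
Perm n = Fin n ⤖ Fin n

S : Set
S = Σ ℕ Perm

∣_∣ₚ : S → ℕ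
∣ (n Data.Product., _) ∣ₚ = n

allL : ∀ {A : Set} → (A → Bool) → List A → Bool
allL p = foldr (λ x b → p x ∧ b) true

-- value σ(i) (as a natural number, 0-based) extended by 0 outside the domain
val : ∀ {n} → Perm n → ℕ → ℕ
val {n} σ i with i <? n
... | Relation.Nullary.yes i<n = toℕ (Bijection.to σ (fromℕ< i<n))
... | Relation.Nullary.no _ = 0

-- σ(i)σ(i+1)...σ(i+k-1) (0-based start i) is order-isomorphic to π (length k):
-- for all a, b < k,  π(a) < π(b)  iff  σ(i+a) < σ(i+b).
occursAt : ∀ {k n} → Perm k → Perm n → ℕ → Bool
occursAt {k} π σ i =
  allL (λ a → allL (λ b → does ((toℕ (Bijection.to π a) <ᵇ toℕ (Bijection.to π b))
                             ≟ (val σ (i + toℕ a) <ᵇ val σ (i + toℕ b))))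
                 (allFin k))
      (allFin k)

occCount : ∀ {k n} → Perm k → Perm n → ℕ
occCount {k} {n} π σ =
  if k ≤ᵇ n
  then sum (map (λ i → if occursAt π σ i then 1 else 0) (upTo (suc (n ∸ k))))
  else 0

-- ρ_k(π, σ) = occCount / (n - k + 1)   (only meaningful for n ≥ k;
-- it is set to 0 when n < k, which is irrelevant for limits since |σ_j| → ∞)
ρ : S → S → ℚ
ρ (k Data.Product., π) (n Data.Product., σ) = (+ occCount π σ) / suc (n ∸ k)

LengthsDiverge : (ℕ → S) → Set
LengthsDiverge σ = ∀ (M : ℕ) → ∃ λ J → ∀ j → J ≤ j → M ≤ ∣ σ j ∣ₚ

Cauchy : (ℕ → ℚ) → Set
Cauchy a = ∀ (ε : ℚ) → 0ℚ <ℚ ε →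
  ∃ λ N → ∀ m n → N ≤ m → N ≤ n → ∣ a m - a n ∣ <ℚ ε

Tends0 : (ℕ → ℚ) → Set
Tends0 a = ∀ (ε : ℚ) → 0ℚ <ℚ ε → ∃ λ N → ∀ ℓ → N ≤ ℓ → ∣ a ℓ ∣ <ℚ ε

-- (σ_j) converges locally to *some* Λ ∈ [0,1]^S, i.e. Λ is a permutation
-- local limit witnessed by σ: |σ_j| → ∞ and for every π the densities
-- ρ(π, σ_j) converge (equivalently, are Cauchy; the limit Λ_π is a real).
ConvergesLocally : (ℕ → S) → Set
ConvergesLocally σ = LengthsDiverge σ × (∀ (π : S) → Cauchy (λ j → ρ π (σ j)))

-- τ (with |τ_ℓ| = ℓ) converges locally to the same Λ as σ:
-- for every π, ρ(π,τ_ℓ) - ρ(π,σ_ℓ) → 0.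
SameLocalLimit : (τ : (ℓ : ℕ) → Perm ℓ) → (ℕ → S) → Set
SameLocalLimit τ σ = ∀ (π : S) → Tends0 (λ ℓ → ρ π (ℓ Data.Product., τ ℓ) - ρ π (σ ℓ))

module Submission where

open import Defs
open import Data.Nat using (ℕ)
open import Data.Product using (∃)

-- Given σ_j converging locally, let τ_ℓ be the block permutation of
-- length ℓ built from a suitable σ_j: ⌊ℓ/n⌋ copies of σ_j (n = |σ_j|),
-- shifted into consecutive increasing blocks, followed by the identity.
-- A window of length k inside one copy is a translate of the matching
-- window of σ_j, so it contains π exactly when that one does. Hence the
-- number of occurrences of π in τ_ℓ is M = ⌊ℓ/n⌋ times that in σ_j, up to
-- an error of k - 1 per copy plus the leftover r < n; when n ≥ (K+1)k and
-- ℓ ≥ n² this moves the density by less than 1/K. Taking for σ_j the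
-- latest sequence member with |σ_j|² ≤ ℓ makes j → ∞ with ℓ, and the
-- Cauchy property of ρ(π, σ_j) carries the estimate over to σ_ℓ.

module FiniteSums where

  open import Data.Nat
  open import Data.Nat.Properties
  open import Data.Nat.ListAction using (sum)
  open import Data.List using (map; applyUpTo)
  open import Data.Product using (_,_)
  open import Relation.Binary.PropositionalEquality

  sumTo : (ℕ → ℕ) → ℕ → ℕ
  sumTo f n = sum (applyUpTo f n)

  sum-map-applyUpTo : ∀ (f g : ℕ → ℕ) n → sum (map f (applyUpTo g n)) ≡ sumTo (λ i → f (g i)) n
  sum-map-applyUpTo f g zero    = refl
  sum-map-applyUpTo f g (suc n) = cong (f (g 0) +_) (sum-map-applyUpTo f (λ i → g (suc i)) n)

  sumTo-+ : ∀ f m n → sumTo f (m + n) ≡ sumTo f m + sumTo (λ i → f (m + i)) n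
  sumTo-+ f zero    n = refl
  sumTo-+ f (suc m) n = trans (cong (f 0 +_) (sumTo-+ (λ i → f (suc i)) m n)) (sym (+-assoc (f 0) _ _))

  sumTo-cong : ∀ f g n → (∀ i → i < n → f i ≡ g i) → sumTo f n ≡ sumTo g n
  sumTo-cong f g zero    f≗g = refl
  sumTo-cong f g (suc n) f≗g = cong₂ _+_ (f≗g 0 z<s) (sumTo-cong _ _ n (λ i i<n → f≗g (suc i) (s<s i<n)))

  sumTo-monoˡ : ∀ f {m n} → m ≤ n → sumTo f m ≤ sumTo f n
  sumTo-monoˡ f {m} m≤n with m≤n⇒∃[o]m+o≡n m≤n
  ... | o , refl = subst (sumTo f m ≤_) (sym (sumTo-+ f m o)) (m≤m+n (sumTo f m) _)

  sumTo-≤-length : ∀ f n → (∀ i → f i ≤ 1) → sumTo f n ≤ n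
  sumTo-≤-length f zero    f≤1 = z≤n
  sumTo-≤-length f (suc n) f≤1 = +-mono-≤ (f≤1 0) (sumTo-≤-length _ n (λ i → f≤1 (suc i)))

  sumTo-extend : ∀ f m n → (∀ i → f i ≤ 1) → sumTo f (m + n) ≤ sumTo f m + n
  sumTo-extend f m n f≤1 = subst (_≤ sumTo f m + n) (sym (sumTo-+ f m n))
                             (+-monoʳ-≤ (sumTo f m) (sumTo-≤-length _ n (λ i → f≤1 (m + i))))

  Repeats : (W V : ℕ → ℕ) (n d M : ℕ) → Set
  Repeats W V n d M = ∀ q o → q < M → o < d → W (q * n + o) ≡ V o

  Repeats-shift : ∀ {W V n d M} → Repeats W V n d (suc M) → Repeats (λ i → W (n + i)) V n d M
  Repeats-shift {W} {n = n} rep q o q<M o<d =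
    trans (cong W (sym (+-assoc n (q * n) o))) (rep (suc q) o (s<s q<M) o<d)

  Repeats-head : ∀ {W V n d M} → Repeats W V n d (suc M) → sumTo W d ≡ sumTo V d
  Repeats-head {W} {V} {d = d} rep = sumTo-cong W V d (λ o o<d → rep 0 o z<s o<d)

  Repeats-lower : ∀ {W V n d} m → d ≤ n → Repeats W V n d (suc m) →
                  suc m * sumTo V d ≤ sumTo W (m * n + d)
  Repeats-lower {W} {V} {n} {d} zero    d≤n rep =
    ≤-reflexive (trans (+-identityʳ (sumTo V d)) (sym (Repeats-head rep)))
  Repeats-lower {W} {V} {n} {d} (suc m) d≤n rep = begin
    sumTo V d + suc m * sumTo V d       ≤⟨ +-mono-≤ (≤-reflexive (sym (Repeats-head rep))) (Repeats-lower m d≤n (Repeats-shift {W} rep)) ⟩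
    sumTo W d + sumTo W′ (m * n + d)    ≤⟨ +-monoˡ-≤ _ (sumTo-monoˡ W d≤n) ⟩
    sumTo W n + sumTo W′ (m * n + d)    ≡⟨ sumTo-+ W n (m * n + d) ⟨
    sumTo W (n + (m * n + d))           ≡⟨ cong (sumTo W) (+-assoc n (m * n) d) ⟨
    sumTo W (suc m * n + d)             ∎
    where
    open ≤-Reasoning
    W′ = λ i → W (n + i)

  Repeats-upper : ∀ {W V n d} e M → n ≤ d + e → (∀ i → W i ≤ 1) → Repeats W V n d M →
                  sumTo W (M * n) ≤ M * (sumTo V d + e)
  Repeats-upper e zero    n≤d+e W≤1 rep = z≤n
  Repeats-upper {W} {V} {n} {d} e (suc M) n≤d+e W≤1 rep = begin
    sumTo W (n + M * n)                 ≡⟨ sumTo-+ W n (M * n) ⟩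
    sumTo W n + sumTo W′ (M * n)        ≤⟨ +-mono-≤ one-period (Repeats-upper e M n≤d+e (λ i → W≤1 (n + i)) (Repeats-shift {W} rep)) ⟩
    (sumTo V d + e) + M * (sumTo V d + e) ∎
    where
    open ≤-Reasoning
    W′ = λ i → W (n + i)
    one-period : sumTo W n ≤ sumTo V d + e
    one-period = begin
      sumTo W n         ≤⟨ sumTo-monoˡ W n≤d+e ⟩
      sumTo W (d + e)   ≤⟨ sumTo-extend W d e W≤1 ⟩
      sumTo W d + e     ≡⟨ cong (_+ e) (Repeats-head rep) ⟩
      sumTo V d + e     ∎

  sumTo-ones : ∀ n → sumTo (λ _ → 1) n ≡ n
  sumTo-ones zero    = refl
  sumTo-ones (suc n) = cong suc (sumTo-ones n)

module Fractions where

  open import Data.Nat as ℕ using (suc)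
  import Data.Nat.Properties as ℕ
  open import Data.Nat.Tactic.RingSolver using (solve-∀)
  open import Data.Integer as ℤ using (+_; +[1+_]; -[1+_]; +<+; +≤+)
  import Data.Integer.Properties as ℤ
  open import Data.Rational
  open import Data.Rational.Properties
  open import Data.Rational.Solver using (module +-*-Solver)
  import Data.Rational.Unnormalised as ℚᵘ
  import Data.Rational.Unnormalised.Properties as ℚᵘ
  open import Data.Product using (∃; _,_)
  open import Data.Sum using (inj₁; inj₂)
  open import Relation.Binary.PropositionalEquality

  toℚᵘ-/ : ∀ a b-1 → toℚᵘ ((+ a) / suc b-1) ℚᵘ.≃ ℚᵘ.mkℚᵘ (+ a) b-1
  toℚᵘ-/ a b-1 = toℚᵘ-fromℚᵘ (ℚᵘ.mkℚᵘ (+ a) b-1)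

  cast-cross : ∀ b c d k → + ((c ℕ.* k ℕ.+ d) ℕ.* b) ≡ (+ c ℤ.* + k ℤ.+ + 1 ℤ.* + d) ℤ.* + b
  cast-cross b c d k = begin
    + ((c ℕ.* k ℕ.+ d) ℕ.* b)          ≡⟨ ℤ.pos-* (c ℕ.* k ℕ.+ d) b ⟩
    + (c ℕ.* k ℕ.+ d) ℤ.* + b          ≡⟨ cong (ℤ._* + b) (ℤ.pos-+ (c ℕ.* k) d) ⟩
    (+ (c ℕ.* k) ℤ.+ + d) ℤ.* + b      ≡⟨ cong (λ x → (x ℤ.+ + d) ℤ.* + b) (ℤ.pos-* c k) ⟩
    (+ c ℤ.* + k ℤ.+ + d) ℤ.* + b      ≡⟨ cong (λ x → (+ c ℤ.* + k ℤ.+ x) ℤ.* + b) (ℤ.*-identityˡ (+ d)) ⟨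
    (+ c ℤ.* + k ℤ.+ + 1 ℤ.* + d) ℤ.* + b ∎
    where open ≡-Reasoning

  /<-/+1/ : ∀ a b-1 c d-1 k-1 → let b = suc b-1; d = suc d-1; k = suc k-1 in
            a ℕ.* (d ℕ.* k) ℕ.< (c ℕ.* k ℕ.+ d) ℕ.* b →
            (+ a) / b < (+ c) / d + (+ 1) / k
  /<-/+1/ a b-1 c d-1 k-1 cross = toℚᵘ-cancel-< (begin-strict
      toℚᵘ ((+ a) / b)                         ≃⟨ toℚᵘ-/ a b-1 ⟩
      ℚᵘ.mkℚᵘ (+ a) b-1                         <⟨ ℚᵘ.*<* cross′ ⟩
      ℚᵘ.mkℚᵘ (+ c) d-1 ℚᵘ.+ ℚᵘ.mkℚᵘ (+ 1) k-1  ≃⟨ ℚᵘ.+-cong (toℚᵘ-/ c d-1) (toℚᵘ-/ 1 k-1) ⟨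
      toℚᵘ ((+ c) / d) ℚᵘ.+ toℚᵘ ((+ 1) / k)   ≃⟨ toℚᵘ-homo-+ ((+ c) / d) ((+ 1) / k) ⟨
      toℚᵘ ((+ c) / d + (+ 1) / k)              ∎)
    where
    open ℚᵘ.≤-Reasoning
    b = suc b-1; d = suc d-1; k = suc k-1
    cross′ : + a ℤ.* + (d ℕ.* k) ℤ.< (+ c ℤ.* + k ℤ.+ + 1 ℤ.* + d) ℤ.* + b
    cross′ = subst₂ ℤ._<_ (ℤ.pos-* a (d ℕ.* k)) (cast-cross b c d k) (+<+ cross)

  -- Archimedean property, in the form used for a two-step triangle estimate:
  -- every positive rational ε dominates 1/k + 1/k for some k.
  archimedean-half : ∀ ε → 0ℚ < ε → ∃ λ k-1 → (+ 1) / suc k-1 + (+ 1) / suc k-1 ≤ ε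
  archimedean-half (mkℚ +[1+ p ] d-1 _) _ = k-1 , toℚᵘ-cancel-≤ (begin
      toℚᵘ (1/k + 1/k)                         ≃⟨ toℚᵘ-homo-+ 1/k 1/k ⟩
      toℚᵘ 1/k ℚᵘ.+ toℚᵘ 1/k                   ≃⟨ ℚᵘ.+-cong (toℚᵘ-/ 1 k-1) (toℚᵘ-/ 1 k-1) ⟩
      ℚᵘ.mkℚᵘ (+ 1) k-1 ℚᵘ.+ ℚᵘ.mkℚᵘ (+ 1) k-1  ≤⟨ ℚᵘ.*≤* (subst₂ ℤ._≤_ (cast-cross d 1 k k) (ℤ.pos-* (suc p) (k ℕ.* k)) (+≤+ twice)) ⟩
      ℚᵘ.mkℚᵘ +[1+ p ] d-1                      ∎)
    where
    open ℚᵘ.≤-Reasoning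
    d = suc d-1
    k-1 = d-1 ℕ.+ d
    k = suc k-1
    1/k = (+ 1) / k
    -- with k = 2d we have (1·k + k)·d = k·k
    twice : (1 ℕ.* k ℕ.+ k) ℕ.* d ℕ.≤ suc p ℕ.* (k ℕ.* k)
    twice = ℕ.≤-trans (ℕ.≤-reflexive (square d)) (ℕ.m≤n*m (k ℕ.* k) (suc p))
      where
      square : ∀ d → (1 ℕ.* (d ℕ.+ d) ℕ.+ (d ℕ.+ d)) ℕ.* d ≡ (d ℕ.+ d) ℕ.* (d ℕ.+ d)
      square = solve-∀
  archimedean-half (mkℚ (+ 0) _ _) (*<* (+<+ ()))
  archimedean-half (mkℚ -[1+ _ ] _ _) (*<* ())

  -<-intro : ∀ p q r → p < q + r → p - q < r
  -<-intro p q r p<q+r = subst (p - q <_) (solve 2 (λ q r → (q :+ r) :- q := r) refl q r) (+-monoˡ-< (- q) p<q+r)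
    where open +-*-Solver

  ∣-∣<-intro : ∀ p q r → p < q + r → q < p + r → ∣ p - q ∣ < r
  ∣-∣<-intro p q r p<q+r q<p+r with ∣p∣≡p∨∣p∣≡-p (p - q)
  ... | inj₁ ∣p-q∣≡p-q = subst (_< r) (sym ∣p-q∣≡p-q) (-<-intro p q r p<q+r)
  ... | inj₂ ∣p-q∣≡q-p = subst (_< r) (sym (trans ∣p-q∣≡q-p (solve 2 (λ p q → :- (p :- q) := q :- p) refl p q)))
                                (-<-intro q p r q<p+r)
    where open +-*-Solver

  ∣-∣<-trans : ∀ x y z δ ε → ∣ x - y ∣ < δ → ∣ y - z ∣ < δ → δ + δ ≤ ε → ∣ x - z ∣ < ε
  ∣-∣<-trans x y z δ ε xy yz 2δ≤ε = <-≤-trans (≤-<-trans triangle (+-mono-< xy yz)) 2δ≤ε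
    where
    open +-*-Solver
    triangle : ∣ x - z ∣ ≤ ∣ x - y ∣ + ∣ y - z ∣
    triangle = subst (λ w → ∣ w ∣ ≤ ∣ x - y ∣ + ∣ y - z ∣)
                     (solve 3 (λ x y z → (x :- y) :+ (y :- z) := x :- z) refl x y z)
                     (∣p+q∣≤∣p∣+∣q∣ (x - y) (y - z))

  n/n≡1 : ∀ n-1 → (+ suc n-1) / suc n-1 ≡ 1ℚ
  n/n≡1 n-1 = toℚᵘ-injective (ℚᵘ.≃-trans (toℚᵘ-/ (suc n-1) n-1)
                               (ℚᵘ.*≡* (trans (ℤ.*-identityʳ (+ suc n-1)) (sym (ℤ.*-identityˡ (+ suc n-1))))))

  ∣p-p∣<ε : ∀ p ε → 0ℚ < ε → ∣ p - p ∣ < ε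
  ∣p-p∣<ε p ε 0<ε = subst (λ x → ∣ x ∣ < ε) (sym (+-inverseʳ p)) 0<ε

  1/k-pos : ∀ k-1 → 0ℚ < (+ 1) / suc k-1
  1/k-pos k-1 = positive⁻¹ ((+ 1) / suc k-1) {{normalize-pos 1 (suc k-1)}}

module Permutations where

  open import Data.Nat
  open import Data.Nat.Properties
  open import Data.Fin using (Fin; toℕ; fromℕ<)
  open import Data.Fin.Properties using (toℕ<n; toℕ-fromℕ<; fromℕ<-toℕ; toℕ-injective)
  open import Function.Bundles using (Bijection; Inverse; mk↔ₛ′)
  open import Function.Properties.Bijection using (⤖⇒↔)
  open import Function.Properties.Inverse using (↔⇒⤖; ↔-sym)
  open import Relation.Binary.PropositionalEquality
  open import Relation.Nullary using (yes; no; contradiction)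

  open Bijection using (to)

  val-lookup : ∀ {n} (σ : Perm n) {x} (x<n : x < n) → val σ x ≡ toℕ (to σ (fromℕ< x<n))
  val-lookup {n} σ {x} x<n with x <? n
  ... | yes _   = refl
  ... | no x≮n = contradiction x<n x≮n

  val-toℕ : ∀ {n} (σ : Perm n) (i : Fin n) → val σ (toℕ i) ≡ toℕ (to σ i)
  val-toℕ σ i = trans (val-lookup σ (toℕ<n i)) (cong (λ j → toℕ (to σ j)) (fromℕ<-toℕ i (toℕ<n i)))

  val-< : ∀ {n} (σ : Perm n) {x} → x < n → val σ x < n
  val-< σ x<n = subst (_< _) (sym (val-lookup σ x<n)) (toℕ<n _)

  _⁻¹ : ∀ {n} → Perm n → Perm n
  σ ⁻¹ = ↔⇒⤖ (↔-sym (⤖⇒↔ σ))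

  val-cancel : ∀ {n} (σ τ : Perm n) → (∀ i → to τ (to σ i) ≡ i) → ∀ {x} → x < n → val τ (val σ x) ≡ x
  val-cancel σ τ τσ≗id {x} x<n = begin
    val τ (val σ x)                         ≡⟨ cong (val τ) (val-lookup σ x<n) ⟩
    val τ (toℕ (to σ (fromℕ< x<n)))         ≡⟨ val-toℕ τ _ ⟩
    toℕ (to τ (to σ (fromℕ< x<n)))          ≡⟨ cong toℕ (τσ≗id _) ⟩
    toℕ (fromℕ< x<n)                        ≡⟨ toℕ-fromℕ< x<n ⟩
    x                                       ∎
    where open ≡-Reasoning

  val-⁻¹-val : ∀ {n} (σ : Perm n) {x} → x < n → val (σ ⁻¹) (val σ x) ≡ x
  val-⁻¹-val σ = val-cancel σ (σ ⁻¹) (Inverse.strictlyInverseʳ (⤖⇒↔ σ))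

  val-val-⁻¹ : ∀ {n} (σ : Perm n) {x} → x < n → val σ (val (σ ⁻¹) x) ≡ x
  val-val-⁻¹ σ = val-cancel (σ ⁻¹) σ (Inverse.strictlyInverseˡ (⤖⇒↔ σ))

  record InversePair (L : ℕ) : Set where
    field
      forth back : ℕ → ℕ
      forth-< : ∀ {x} → x < L → forth x < L
      back-< : ∀ {x} → x < L → back x < L
      back-forth : ∀ {x} → x < L → back (forth x) ≡ x
      forth-back : ∀ {x} → x < L → forth (back x) ≡ x

  toPerm : ∀ {L} → InversePair L → Perm L
  toPerm {L} P = ↔⇒⤖ (mk↔ₛ′ (onFin forth forth-<) (onFin back back-<)
                            (λ i → toℕ-injective (onFin-cancel forth forth-< back back-< forth-back i))
                            (λ i → toℕ-injective (onFin-cancel back back-< forth forth-< back-forth i)))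
    where
    open InversePair P
    onFin : (f : ℕ → ℕ) → (∀ {x} → x < L → f x < L) → Fin L → Fin L
    onFin f f-< i = fromℕ< (f-< (toℕ<n i))
    onFin-cancel : ∀ f (f-< : ∀ {x} → x < L → f x < L) g (g-< : ∀ {x} → x < L → g x < L) →
                   (∀ {x} → x < L → f (g x) ≡ x) →
                   ∀ i → toℕ (onFin f f-< (onFin g g-< i)) ≡ toℕ i
    onFin-cancel f f-< g g-< fg≗id i =
      trans (toℕ-fromℕ< _) (trans (cong f (toℕ-fromℕ< _)) (fg≗id (toℕ<n i)))

  val-toPerm : ∀ {L} (P : InversePair L) {x} → x < L → val (toPerm P) x ≡ InversePair.forth P x
  val-toPerm P {x} x<L = trans (val-lookup (toPerm P) x<L)
                               (trans (toℕ-fromℕ< _) (cong (InversePair.forth P) (toℕ-fromℕ< x<L)))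

module BlockPermutations where

  open Permutations
  open import Data.Nat
  open import Data.Nat.Properties
  open import Data.Nat.DivMod using (m/n*n≤m; m%n<n; m≡m%n+[m/n]*n; /-monoˡ-≤; m*n/n≡m)
    renaming (_/_ to _div_; _%_ to _mod_)
  open import Data.Product using (∃; _×_; _,_)
  open import Data.Sum using (_⊎_; inj₁; inj₂)
  open import Relation.Binary.PropositionalEquality
  open import Relation.Nullary using (yes; no; contradiction)

  blocks : ℕ → (ℕ → ℕ) → ℕ → ℕ → ℕ
  blocks n φ zero    x = x
  blocks n φ (suc M) x with x <? n
  ... | yes _ = φ x
  ... | no  _ = n + blocks n φ M (x ∸ n)

  blocks-first : ∀ {n} φ M {x} → x < n → blocks n φ (suc M) x ≡ φ x
  blocks-first {n} φ M {x} x<n with x <? n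
  ... | yes _   = refl
  ... | no x≮n = contradiction x<n x≮n

  blocks-later : ∀ n φ M y → blocks n φ (suc M) (n + y) ≡ n + blocks n φ M y
  blocks-later n φ M y with n + y <? n
  ... | yes n+y<n = contradiction n+y<n (m+n≮m n y)
  ... | no  _     = cong (λ z → n + blocks n φ M z) (m+n∸m≡n n y)

  first-or-later : ∀ n x → x < n ⊎ ∃ λ y → x ≡ n + y
  first-or-later n x with x <? n
  ... | yes x<n = inj₁ x<n
  ... | no  x≮n = inj₂ (x ∸ n , sym (m+[n∸m]≡n (≮⇒≥ x≮n)))

  blocks-value : ∀ {n} φ {M} q {y} → q < M → y < n → blocks n φ M (q * n + y) ≡ q * n + φ y
  blocks-value {n} φ {suc M} zero    {y} _         y<n = blocks-first φ M y<n
  blocks-value {n} φ {suc M} (suc q) {y} (s<s q<M) y<n = begin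
    blocks n φ (suc M) ((n + q * n) + y)   ≡⟨ cong (blocks n φ (suc M)) (+-assoc n (q * n) y) ⟩
    blocks n φ (suc M) (n + (q * n + y))   ≡⟨ blocks-later n φ M (q * n + y) ⟩
    n + blocks n φ M (q * n + y)           ≡⟨ cong (n +_) (blocks-value φ q q<M y<n) ⟩
    n + (q * n + φ y)                      ≡⟨ +-assoc n (q * n) (φ y) ⟨
    (n + q * n) + φ y                      ∎
    where open ≡-Reasoning

  blocks-< : ∀ {n} φ → (∀ {x} → x < n → φ x < n) → ∀ M {L x} → M * n ≤ L → x < L → blocks n φ M x < L
  blocks-< φ φ-< zero    Mn≤L x<L = x<L
  blocks-< {n} φ φ-< (suc M) {L} {x} Mn≤L x<L with first-or-later n x
  ... | inj₁ x<n = subst (_< L) (sym (blocks-first φ M x<n)) (<-≤-trans (φ-< x<n) (≤-trans (m≤m+n n (M * n)) Mn≤L))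
  ... | inj₂ (y , refl) with m≤n⇒∃[o]m+o≡n (≤-trans (m≤m+n n (M * n)) Mn≤L)
  ...   | L′ , refl = subst (_< n + L′) (sym (blocks-later n φ M y))
            (+-monoʳ-< n (blocks-< φ φ-< M (+-cancelˡ-≤ n _ _ Mn≤L) (+-cancelˡ-< n _ _ x<L)))

  blocks-cancel : ∀ {n} φ ψ → (∀ {x} → x < n → φ x < n) → (∀ {x} → x < n → ψ (φ x) ≡ x) →
                  ∀ M x → blocks n ψ M (blocks n φ M x) ≡ x
  blocks-cancel φ ψ φ-< ψφ≗id zero    x = refl
  blocks-cancel {n} φ ψ φ-< ψφ≗id (suc M) x with first-or-later n x
  ... | inj₁ x<n = begin
    blocks n ψ (suc M) (blocks n φ (suc M) x)   ≡⟨ cong (blocks n ψ (suc M)) (blocks-first φ M x<n) ⟩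
    blocks n ψ (suc M) (φ x)                    ≡⟨ blocks-first ψ M (φ-< x<n) ⟩
    ψ (φ x)                                     ≡⟨ ψφ≗id x<n ⟩
    x                                           ∎
    where open ≡-Reasoning
  ... | inj₂ (y , refl) = begin
    blocks n ψ (suc M) (blocks n φ (suc M) (n + y))   ≡⟨ cong (blocks n ψ (suc M)) (blocks-later n φ M y) ⟩
    blocks n ψ (suc M) (n + blocks n φ M y)           ≡⟨ blocks-later n ψ M (blocks n φ M y) ⟩
    n + blocks n ψ M (blocks n φ M y)                 ≡⟨ cong (n +_) (blocks-cancel φ ψ φ-< ψφ≗id M y) ⟩
    n + y                                             ∎
    where open ≡-Reasoning

  copies : ℕ → ℕ → ℕ
  copies ℓ zero         = 0
  copies ℓ n@(suc _) = ℓ div n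

  copies-fit : ∀ ℓ n → copies ℓ n * n ≤ ℓ
  copies-fit ℓ zero        = z≤n
  copies-fit ℓ n@(suc _) = m/n*n≤m ℓ n

  copies-division : ∀ ℓ n → 0 < n → ∃ λ r → r < n × ℓ ≡ r + copies ℓ n * n
  copies-division ℓ n@(suc _) _ = ℓ mod n , m%n<n ℓ n , m≡m%n+[m/n]*n ℓ n

  copies-large : ∀ ℓ n → n * n ≤ ℓ → n ≤ copies ℓ n
  copies-large ℓ zero        _    = z≤n
  copies-large ℓ n@(suc _) n²≤ℓ = subst (_≤ ℓ div n) (m*n/n≡m n n) (/-monoˡ-≤ n n²≤ℓ)

  blockPair : ∀ ℓ {n} → Perm n → InversePair ℓ
  blockPair ℓ {n} σ = record
    { forth      = blocks n (val σ) M
    ; back       = blocks n (val (σ ⁻¹)) M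
    ; forth-<    = blocks-< (val σ) (val-< σ) M (copies-fit ℓ n)
    ; back-<     = blocks-< (val (σ ⁻¹)) (val-< (σ ⁻¹)) M (copies-fit ℓ n)
    ; back-forth = λ {x} _ → blocks-cancel (val σ) (val (σ ⁻¹)) (val-< σ) (val-⁻¹-val σ) M x
    ; forth-back = λ {x} _ → blocks-cancel (val (σ ⁻¹)) (val σ) (val-< (σ ⁻¹)) (val-val-⁻¹ σ) M x
    }
    where M = copies ℓ n

  blockPerm : ∀ ℓ {n} → Perm n → Perm ℓ
  blockPerm ℓ σ = toPerm (blockPair ℓ σ)

  val-blockPerm : ∀ ℓ {n} (σ : Perm n) q {y} → q < copies ℓ n → y < n →
                  val (blockPerm ℓ σ) (q * n + y) ≡ q * n + val σ y
  val-blockPerm ℓ {n} σ q {y} q<M y<n =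
    trans (val-toPerm (blockPair ℓ σ) inside) (blocks-value (val σ) q q<M y<n)
    where
    inside : q * n + y < ℓ
    inside = <-≤-trans (+-monoʳ-< (q * n) y<n)
               (≤-trans (≤-reflexive (+-comm (q * n) n)) (≤-trans (*-monoˡ-≤ n q<M) (copies-fit ℓ n)))

module DensityArithmetic where

  open FiniteSums
  open import Data.Nat
  open import Data.Nat.Properties
  open import Data.Nat.Tactic.RingSolver using (solve-∀)
  open import Data.Product using (_×_; _,_)
  open import Relation.Binary.PropositionalEquality

  -- A length-n sequence has n - k + 1 windows of length k = e + 1.
  windows+e : ∀ e {n} → suc e ≤ n → suc (n ∸ suc e) + e ≡ n
  windows+e e {n} k≤n = trans (sym (+-suc (n ∸ suc e) e)) (m∸n+n≡m k≤n)

  ≤-copies : ∀ {k n M} r → k ≤ n → 1 ≤ M → k ≤ r + M * n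
  ≤-copies {k} {n} {M} r k≤n 1≤M =
    ≤-trans k≤n (≤-trans (≤-reflexive (sym (*-identityˡ n))) (≤-trans (*-monoˡ-≤ n 1≤M) (m≤n+m (M * n) r)))

  window-bounds : ∀ {b d e r} M → 1 ≤ M → b + e ≡ r + M * (d + e) → M * d ≤ b × b ≤ M * d + (M * e + r)
  window-bounds {b} {d} {e} {r} (suc m) _ b+e≡ = lower , upper
    where
    b≡ : b ≡ suc m * d + (m * e + r)
    b≡ = +-cancelʳ-≡ _ _ _ (trans b+e≡ (identity r m d e))
      where
      identity : ∀ r m d e → r + suc m * (d + e) ≡ (suc m * d + (m * e + r)) + e
      identity = solve-∀
    lower : suc m * d ≤ b
    lower = subst (suc m * d ≤_) (sym b≡) (m≤m+n _ _)
    upper : b ≤ suc m * d + (suc m * e + r)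
    upper = subst (_≤ suc m * d + (suc m * e + r)) (sym b≡)
                  (+-monoʳ-≤ (suc m * d) (+-monoˡ-≤ r (*-monoˡ-≤ e (n≤1+n m))))

  -- Counting a 0/1 sequence W that repeats the pattern V in M ≥ 1 periods of
  -- length n = d + e, over a range b with b + e = r + M·n: we see the
  -- pattern M times, plus at most e extra per period and r at the end.
  count-bounds : ∀ {W V n d e} M r b → 1 ≤ M → d + e ≡ n → (∀ i → W i ≤ 1) → Repeats W V n d M →
                 b + e ≡ r + M * n →
                 M * sumTo V d ≤ sumTo W b × sumTo W b ≤ M * sumTo V d + (M * e + r)
  count-bounds {W} {V} {d = d} {e} (suc m) r b _ refl W≤1 rep b+e≡ = lower , upper
    where
    n = d + e
    s = sumTo V d
    lower : suc m * s ≤ sumTo W b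
    lower = ≤-trans (Repeats-lower m (m≤m+n d e) rep) (sumTo-monoˡ W (+-cancelʳ-≤ e _ _ ends-before))
      where
      ends-before : (m * n + d) + e ≤ b + e
      ends-before = begin
        (m * n + d) + e    ≡⟨ +-assoc (m * n) d e ⟩
        m * n + n          ≡⟨ +-comm (m * n) n ⟩
        suc m * n          ≤⟨ m≤n+m (suc m * n) r ⟩
        r + suc m * n      ≡⟨ b+e≡ ⟨
        b + e              ∎
        where open ≤-Reasoning
    upper : sumTo W b ≤ suc m * s + (suc m * e + r)
    upper = begin
      sumTo W b                      ≤⟨ sumTo-monoˡ W (≤-trans (m≤m+n b e) (≤-reflexive (trans b+e≡ (+-comm r _)))) ⟩
      sumTo W (suc m * n + r)        ≤⟨ sumTo-extend W (suc m * n) r W≤1 ⟩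
      sumTo W (suc m * n) + r        ≤⟨ +-monoˡ-≤ r (Repeats-upper e (suc m) ≤-refl W≤1 rep) ⟩
      suc m * (s + e) + r            ≡⟨ identity (suc m) s e r ⟩
      suc m * s + (suc m * e + r)    ∎
      where
      open ≤-Reasoning
      identity : ∀ M s e r → M * (s + e) + r ≡ M * s + (M * e + r)
      identity = solve-∀

  error-small : ∀ K e d {M r} .{{_ : NonZero K}} → suc K * suc e ≤ d + e → r < M → K * (M * e + r) < M * d
  error-small K e d {M} {r} long r<M = begin-strict
    K * (M * e + r)      <⟨ *-monoʳ-< K (+-monoʳ-< (M * e) r<M) ⟩
    K * (M * e + M)      ≡⟨ identity K M e ⟩
    M * (K * suc e)      ≤⟨ *-monoʳ-≤ M (<⇒≤ Ke<d) ⟩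
    M * d                ∎
    where
    open ≤-Reasoning
    identity : ∀ K M e → K * (M * e + M) ≡ M * (K * suc e)
    identity = solve-∀
    Ke<d : K * suc e < d
    Ke<d = +-cancelʳ-≤ e _ _ (subst (_≤ d + e) (lemma K e) long)
      where
      lemma : ∀ K e → suc K * suc e ≡ suc (K * suc e) + e
      lemma = solve-∀

  -- Cross-multiplied form of |A/b - c/d| < 1/K, when (A, b) equals M·(c, d)
  -- up to an error Y with K·Y < M·d (and c ≤ d).
  cross-estimate : ∀ {A b c d M Y} K .{{_ : NonZero d}} → c ≤ d → M * d ≤ b → b ≤ M * d + Y →
                   M * c ≤ A → A ≤ M * c + Y → K * Y < M * d →
                   A * (d * K) < (c * K + d) * b × c * (b * K) < (A * K + b) * d
  cross-estimate {A} {b} {c} {d} {M} {Y} K c≤d Md≤b b≤ Mc≤A A≤ KY<Md = A-side , c-side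
    where
    open ≤-Reasoning
    P = M * c * (d * K)
    error<main : P + d * (K * Y) < P + d * (M * d)
    error<main = +-monoʳ-< P (*-monoʳ-< d KY<Md)
    A-side : A * (d * K) < (c * K + d) * b
    A-side = begin-strict
      A * (d * K)               ≤⟨ *-monoˡ-≤ (d * K) A≤ ⟩
      (M * c + Y) * (d * K)     ≡⟨ identity₁ M c Y d K ⟩
      P + d * (K * Y)           <⟨ error<main ⟩
      P + d * (M * d)           ≤⟨ +-mono-≤ (≤-trans (≤-reflexive (identity₂ M c d K)) (*-monoʳ-≤ (c * K) Md≤b))
                                            (*-monoʳ-≤ d Md≤b) ⟩
      c * K * b + d * b         ≡⟨ *-distribʳ-+ b (c * K) d ⟨
      (c * K + d) * b           ∎
      where
      identity₁ : ∀ M c Y d K → (M * c + Y) * (d * K) ≡ M * c * (d * K) + d * (K * Y)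
      identity₁ = solve-∀
      identity₂ : ∀ M c d K → M * c * (d * K) ≡ c * K * (M * d)
      identity₂ = solve-∀
    c-side : c * (b * K) < (A * K + b) * d
    c-side = begin-strict
      c * (b * K)               ≤⟨ *-monoʳ-≤ c (*-monoˡ-≤ K b≤) ⟩
      c * ((M * d + Y) * K)     ≡⟨ identity₁ M c Y d K ⟩
      P + c * (K * Y)           ≤⟨ +-monoʳ-≤ P (*-monoˡ-≤ (K * Y) c≤d) ⟩
      P + d * (K * Y)           <⟨ error<main ⟩
      P + d * (M * d)           ≡⟨ identity₂ M c d K ⟩
      M * c * K * d + M * d * d ≤⟨ +-monoˡ-≤ (M * d * d) (*-monoˡ-≤ d (*-monoˡ-≤ K Mc≤A)) ⟩
      A * K * d + M * d * d     ≤⟨ +-monoʳ-≤ (A * K * d) (*-monoˡ-≤ d Md≤b) ⟩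
      A * K * d + b * d         ≡⟨ *-distribʳ-+ d (A * K) b ⟨
      (A * K + b) * d           ∎
      where
      identity₁ : ∀ M c Y d K → c * ((M * d + Y) * K) ≡ M * c * (d * K) + c * (K * Y)
      identity₁ = solve-∀
      identity₂ : ∀ M c d K → M * c * (d * K) + d * (M * d) ≡ M * c * K * d + M * d * d
      identity₂ = solve-∀

module Occurrences where

  open FiniteSums
  open BlockPermutations
  open DensityArithmetic
  open import Data.Product using (_×_)
  open import Data.Nat
  open import Data.Nat.Properties
  open import Data.Bool using (Bool; true; false; if_then_else_; _∧_)
  open import Data.Bool.Properties using (T-≡) renaming (_≟_ to _≟ᵇ_)
  open import Data.Fin using (toℕ)
  open import Data.Fin.Properties using (toℕ<n)
  open import Data.List using ([]; _∷_; allFin)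
  open import Function.Bundles using (Bijection; Equivalence)
  open import Relation.Binary.PropositionalEquality
  open import Relation.Nullary using (does)

  hit : ∀ {k n} → Perm k → Perm n → ℕ → ℕ
  hit π σ i = if occursAt π σ i then 1 else 0

  hit≤1 : ∀ {k n} (π : Perm k) (σ : Perm n) i → hit π σ i ≤ 1
  hit≤1 π σ i with occursAt π σ i
  ... | true  = ≤-refl
  ... | false = z≤n

  occCount-sumTo : ∀ {k n} (π : Perm k) (σ : Perm n) → k ≤ n → occCount π σ ≡ sumTo (hit π σ) (suc (n ∸ k))
  occCount-sumTo {k} {n} π σ k≤n rewrite Equivalence.to T-≡ (≤⇒≤ᵇ k≤n) =
    sum-map-applyUpTo (hit π σ) (λ i → i) (suc (n ∸ k))

  allL-cong : ∀ {A : Set} (p q : A → Bool) xs → (∀ x → p x ≡ q x) → allL p xs ≡ allL q xs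
  allL-cong p q []       p≗q = refl
  allL-cong p q (x ∷ xs) p≗q = cong₂ _∧_ (p≗q x) (allL-cong p q xs p≗q)

  <ᵇ-translate : ∀ c x y → ((c + x) <ᵇ (c + y)) ≡ (x <ᵇ y)
  <ᵇ-translate zero    x y = refl
  <ᵇ-translate (suc c) x y = <ᵇ-translate c x y

  -- Order-isomorphism only sees relative order: if the window of τ at j is
  -- the window of σ at i translated by c, both contain π or neither does.
  occursAt-translate : ∀ {k n m} (π : Perm k) (σ : Perm n) (τ : Perm m) i j c →
                       (∀ a → a < k → val τ (j + a) ≡ c + val σ (i + a)) →
                       occursAt π τ j ≡ occursAt π σ i
  occursAt-translate {k} π σ τ i j c translated =
    allL-cong _ _ (allFin k) λ a → allL-cong _ _ (allFin k) λ b →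
      cong (λ x → does ((toℕ (to π a) <ᵇ toℕ (to π b)) ≟ᵇ x))
           (trans (cong₂ _<ᵇ_ (translated (toℕ a) (toℕ<n a)) (translated (toℕ b) (toℕ<n b)))
                  (<ᵇ-translate c _ _))
    where open Bijection using (to)

  blockPerm-repeats : ∀ ℓ {e n} d (π : Perm (suc e)) (σ : Perm n) → d + e ≤ n →
                      Repeats (hit π (blockPerm ℓ σ)) (hit π σ) n d (copies ℓ n)
  blockPerm-repeats ℓ {e} {n} d π σ d+e≤n q o q<M o<d =
    cong (λ b → if b then 1 else 0) (occursAt-translate π σ (blockPerm ℓ σ) o (q * n + o) (q * n) translated)
    where
    translated : ∀ a → a < suc e → val (blockPerm ℓ σ) (q * n + o + a) ≡ q * n + val σ (o + a)
    translated a a≤e = trans (cong (val (blockPerm ℓ σ)) (+-assoc (q * n) o a))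
                             (val-blockPerm ℓ σ q q<M (<-≤-trans (+-mono-<-≤ o<d (s≤s⁻¹ a≤e)) d+e≤n))

  -- Occurrences of π in the block permutation: with M ≥ 1 copies of σ and
  -- leftover r (ℓ = r + M·n), the count is M times the count c in σ, up to
  -- an excess of at most e per copy (windows straddling two copies) plus r.
  blockPerm-counts : ∀ ℓ {e n} (π : Perm (suc e)) (σ : Perm n) r → suc e ≤ n → 1 ≤ copies ℓ n →
                     ℓ ≡ r + copies ℓ n * n →
                     let M = copies ℓ n; c = occCount π σ; A = occCount π (blockPerm ℓ σ)
                     in M * c ≤ A × A ≤ M * c + (M * e + r)
  blockPerm-counts ℓ {e} {n} π σ r k≤n 1≤M ℓ≡ =
    subst₂ (λ c A → M * c ≤ A × A ≤ M * c + (M * e + r))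
           (sym (occCount-sumTo π σ k≤n)) (sym (occCount-sumTo π (blockPerm ℓ σ) k≤ℓ))
           (count-bounds M r (suc (ℓ ∸ suc e)) 1≤M d+e≡n (hit≤1 π (blockPerm ℓ σ))
                         (blockPerm-repeats ℓ d π σ (≤-reflexive d+e≡n)) (trans (windows+e e k≤ℓ) ℓ≡))
    where
    M = copies ℓ n
    d = suc (n ∸ suc e)
    d+e≡n : d + e ≡ n
    d+e≡n = windows+e e k≤n
    k≤ℓ : suc e ≤ ℓ
    k≤ℓ = subst (suc e ≤_) (sym ℓ≡) (≤-copies r k≤n 1≤M)

open FiniteSums
open Fractions
open BlockPermutations
open Occurrences
open DensityArithmetic
open import Data.Nat as ℕ using (zero; suc; _∸_; _⊔_; z≤n; s≤s)
import Data.Nat.Properties as ℕ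
open import Data.Integer using (+_)
open import Data.Rational using (_/_; _-_; ∣_∣; _<_; 1ℚ)
open import Data.Product using (_×_; _,_; proj₁; proj₂)
open import Data.Sum using (inj₁; inj₂)
open import Relation.Binary.PropositionalEquality using (_≡_; refl; sym; trans; cong; subst; subst₂)
open import Relation.Nullary using (yes; no; contradiction)

empty-density : ∀ (π : Perm 0) (s : S) → ρ (0 , π) s ≡ 1ℚ
empty-density π (n , σ) = trans (cong (λ a → (+ a) / suc n) count) (n/n≡1 n)
  where
  count : occCount π σ ≡ suc n
  count = trans (occCount-sumTo π σ z≤n) (sumTo-ones (suc n))

blockPerm-approximates : ∀ k-1 {e} (π : Perm (suc e)) (s : S) ℓ →
  suc (suc k-1) ℕ.* suc e ℕ.≤ ∣ s ∣ₚ → ∣ s ∣ₚ ℕ.* ∣ s ∣ₚ ℕ.≤ ℓ →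
  ∣ ρ (suc e , π) (ℓ , blockPerm ℓ (proj₂ s)) - ρ (suc e , π) s ∣ < (+ 1) / suc k-1
blockPerm-approximates k-1 {e} π (n , σ) ℓ long square =
  ∣-∣<-intro _ _ _ (/<-/+1/ A (ℓ ∸ suc e) c (n ∸ suc e) k-1 (proj₁ cross))
                   (/<-/+1/ c (n ∸ suc e) A (ℓ ∸ suc e) k-1 (proj₂ cross))
  where
  M = copies ℓ n
  d = suc (n ∸ suc e)
  c = occCount π σ
  A = occCount π (blockPerm ℓ σ)
  k≤n : suc e ℕ.≤ n
  k≤n = ℕ.≤-trans (ℕ.m≤n*m (suc e) (suc (suc k-1))) long
  n≤M : n ℕ.≤ M
  n≤M = copies-large ℓ n square
  1≤M : 1 ℕ.≤ M
  1≤M = ℕ.≤-trans (ℕ.≤-trans (s≤s z≤n) k≤n) n≤M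
  division = copies-division ℓ n (ℕ.≤-trans (s≤s z≤n) k≤n)
  r = proj₁ division
  ℓ≡ : ℓ ≡ r ℕ.+ M ℕ.* n
  ℓ≡ = proj₂ (proj₂ division)
  d+e≡n : d ℕ.+ e ≡ n
  d+e≡n = windows+e e k≤n
  windows = window-bounds M 1≤M (trans (windows+e e (subst (suc e ℕ.≤_) (sym ℓ≡) (≤-copies r k≤n 1≤M)))
                                       (subst (λ x → ℓ ≡ r ℕ.+ M ℕ.* x) (sym d+e≡n) ℓ≡))
  counts = blockPerm-counts ℓ π σ r k≤n 1≤M ℓ≡
  cross = cross-estimate {M = M} {Y = M ℕ.* e ℕ.+ r} (suc k-1)
            (subst (ℕ._≤ d) (sym (occCount-sumTo π σ k≤n)) (sumTo-≤-length (hit π σ) d (hit≤1 π σ)))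
            (proj₁ windows) (proj₂ windows) (proj₁ counts) (proj₂ counts)
            (error-small (suc k-1) e d (subst (suc (suc k-1) ℕ.* suc e ℕ.≤_) (sym d+e≡n) long)
                         (ℕ.<-≤-trans (proj₁ (proj₂ division)) n≤M))

-- σ_j is short enough to be copied |σ_j| times into a permutation of length ℓ.
Fits : (ℕ → S) → ℕ → ℕ → Set
Fits σ ℓ j = ∣ σ j ∣ₚ ℕ.* ∣ σ j ∣ₚ ℕ.≤ ℓ

-- select σ ℓ t is the largest j ≤ t with Fits σ ℓ j (or 0 if there is none).
select : (ℕ → S) → ℕ → ℕ → ℕ
select σ ℓ zero    = 0
select σ ℓ (suc t) with ∣ σ (suc t) ∣ₚ ℕ.* ∣ σ (suc t) ∣ₚ ℕ.≤? ℓ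
... | yes _ = suc t
... | no  _ = select σ ℓ t

select-spec : ∀ σ ℓ t J → J ℕ.≤ t → Fits σ ℓ J → J ℕ.≤ select σ ℓ t × Fits σ ℓ (select σ ℓ t)
select-spec σ ℓ zero    zero z≤n fits = z≤n , fits
select-spec σ ℓ (suc t) J J≤t fits with ∣ σ (suc t) ∣ₚ ℕ.* ∣ σ (suc t) ∣ₚ ℕ.≤? ℓ
... | yes fits′ = J≤t , fits′
... | no  ¬fits with ℕ.m≤n⇒m<n∨m≡n J≤t
...   | inj₁ J<1+t = select-spec σ ℓ t J (ℕ.s≤s⁻¹ J<1+t) fits
...   | inj₂ refl  = contradiction fits ¬fits

tracking : (ℕ → S) → (ℓ : ℕ) → Perm ℓ
tracking σ ℓ = blockPerm ℓ (proj₂ (σ (select σ ℓ ℓ)))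

-- For a non-empty pattern π and large ℓ, the selected σ_j is long compared
-- to π, so τ_ℓ has nearly the density of σ_j, and j is past the Cauchy
-- threshold, so σ_j has nearly the density of σ_ℓ.
tracking-close : ∀ σ → ConvergesLocally σ → ∀ e (π : Perm (suc e)) →
                 Tends0 (λ ℓ → ρ (suc e , π) (ℓ , tracking σ ℓ) - ρ (suc e , π) (σ ℓ))
tracking-close σ (diverges , cauchy) e π ε 0<ε = L , close
  where
  k-1 = proj₁ (archimedean-half ε 0<ε)
  δ = (+ 1) / suc k-1
  N = proj₁ (cauchy (suc e , π) δ (1/k-pos k-1))
  J₀ = proj₁ (diverges (suc (suc k-1) ℕ.* suc e))
  J = N ⊔ J₀
  L = J ⊔ (∣ σ J ∣ₚ ℕ.* ∣ σ J ∣ₚ)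
  -- select σ ℓ ℓ is spelled out rather than named, so that the densities
  -- produced by the two estimates are syntactically those of the goal.
  close : ∀ ℓ → L ℕ.≤ ℓ → ∣ ρ (suc e , π) (ℓ , tracking σ ℓ) - ρ (suc e , π) (σ ℓ) ∣ < ε
  close ℓ L≤ℓ = ∣-∣<-trans (ρ (suc e , π) (ℓ , tracking σ ℓ)) (ρ (suc e , π) (σ (select σ ℓ ℓ))) (ρ (suc e , π) (σ ℓ)) δ ε
    (blockPerm-approximates k-1 π (σ (select σ ℓ ℓ)) ℓ (proj₂ (diverges _) (select σ ℓ ℓ) (ℕ.≤-trans (ℕ.m≤n⊔m N J₀) J≤sel))
                            (proj₂ selected))
    (proj₂ (cauchy (suc e , π) δ (1/k-pos k-1)) (select σ ℓ ℓ) ℓ (ℕ.≤-trans (ℕ.m≤m⊔n N J₀) J≤sel) (ℕ.≤-trans (ℕ.m≤m⊔n N J₀) J≤ℓ))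
    (proj₂ (archimedean-half ε 0<ε))
    where
    J≤ℓ = ℕ.≤-trans (ℕ.m≤m⊔n J _) L≤ℓ
    selected = select-spec σ ℓ ℓ J J≤ℓ (ℕ.≤-trans (ℕ.m≤n⊔m J _) L≤ℓ)
    J≤sel = proj₁ selected

proposition3p7 : (σ : ℕ → S) → ConvergesLocally σ →
    ∃ λ (τ : (ℓ : ℕ) → Perm ℓ) → SameLocalLimit τ σ
proposition3p7 σ converges = tracking σ , tracks
  where
  tracks : SameLocalLimit (tracking σ) σ
  tracks (zero , π) ε 0<ε = 0 , λ ℓ _ →
    subst₂ (λ x y → ∣ x - y ∣ < ε) (sym (empty-density π (ℓ , tracking σ ℓ))) (sym (empty-density π (σ ℓ)))
           (∣p-p∣<ε 1ℚ ε 0<ε)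
  tracks (suc e , π) = tracking-close σ converges e π
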